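{- Let $\hat D$ be a co-loopless Le-diagram of type $(k,n)$ and let $D$ be the filling produced from $\hat D$ by the algorithm described in the context. Then $D$ is a Le-diagram of type $(k+1,n)$.
   Context: Le-diagrams. For $0\le k\le n$, a Le-diagram of type $(k,n)$ is a filling of a Young diagram $\lambda$ (English convention, placed in the top-left corner of a $k\times(n-k)$ rectangle and fitting inside it) with symbols $0$ and $+$ such that no box containing $0$ has both a $+$ somewhere above it in its column and a $+$ somewhere to its left in its row. The south-east boundary of $\lambda$ is a lattice path of $n$ unit steps from the top-right to the bottom-left corner of the rectangle; label its steps $1,\dots,n$ in order. Labels of vertical steps are row labels (each of the $k$ rows, possibly of length $0$, gets the label of the vertical step at its right end); labels of horizontal steps are column labels. Box $(i,j)$ is the box in row $i$ and column $j$ (if it lies in $\lambda$; then $i<j$). "Below" means larger row label, "to the left" means larger column label. Decorated permutation $\hat\pi$ of $\hat D$: replace each $0$ by a crossing and each $+$ by an elbow (a pipe entering from the bottom exits to the left, one entering from the right exits at the top); label the north-west boundary so each row's left end carries its row label and each column's top carries its column label; the pipe from boundary step $i$ (moving left from a row label, up from a column label) exits at label $j$, and $\hat\pi(i)=j$; fixed points that are row labels are co-loops. $\hat D$ is co-loopless if $\hat\pi$ has no co-loops, equivalently every row of $\hat D$ is nonempty and contains a $+$. The algorithm. Let the row labels of $\hat D$ be $b_1<\dots<b_k$ and $a_n=\hat\pi(1)$ (a column label of $\hat D$). $D$ has the Young-diagram shape of type $(k+1,n)$ whose row labels are $\{b_1,\dots,b_k,a_n\}$. For a row $b_u$ of $\hat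 D$ let $L_u$ be the column label of the leftmost $+$ in row $b_u$ of $\hat D$; for row $a_n$ set $L=\infty$ and regard the corresponding row of $\hat D$ as consisting only of $0$'s. For a row $r$ of $D$ let $W(r)$ be the label of the next row of $D$ below $r$, or $n+1$ if $r$ is the last row. A $0$ in $\hat D$ is restricted if some box to its left in the same row contains $+$, unrestricted otherwise. For a row $r$ of $D$ and column $\ell$ of $D$: (i) $\hat D$ has $+$ at $(r,\ell)$ (never for $r=a_n$); (ii) there is a row label $b'>r$ of $\hat D$ with $+$ at $(b',\ell)$ in $\hat D$ such that every box $(b,\ell)$ of $\hat D$ with $b$ a row label, $r<b<b'$, contains an unrestricted $0$; (iii) every existing box $(b,\ell)$ of $\hat D$ with $b$ a row label of $\hat D$, $b>r$, contains an unrestricted $0$. Row types: (I) rows $b_u$ for which box $(b_u,a_n)$ of $\hat D$ does not exist or contains $0$; (II) rows $b_u$ with $+$ at $(b_u,a_n)$ in $\hat D$; (III) row $a_n$. For a row $r$ of type (I) or (III), with $L=L_u$ (resp. $\infty$) and $W=W(r)$, each box $(r,\ell)$ of $D$ gets: $+$ if $r<\ell<\min(W,L)$; if $W<\ell<L$, $+$ when (i), (ii) or (iii) holds and $0$ otherwise; $0$ if $\ell\ge L$. For a row $r=b_u$ of type (II): boxes with $\ell<a_n$ follow the type (I) rule; boxes with $\ell>a_n$ get $+$ exactly when $\hat D$ has $+$ at $(r,\ell)$, else $0$. -}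

module Defs where

open import Data.Nat using (ℕ; zero; suc; _+_; _*_; _∸_; _≤_; _<_; _≡ᵇ_; _<ᵇ_)
open import Data.Bool using (Bool; true; false; not; _∧_; _∨_; if_then_else_)
open import Data.Maybe using (Maybe; just; nothing; maybe)
open import Data.Product using (Σ; ∃; _×_; _,_)
open import Data.Sum using (_⊎_)
open import Relation.Nullary using (¬_)
open import Relation.Binary.PropositionalEquality using (_≡_; _≢_)
open import Function.Bundles using (_⇔_)

-- Representation of fillings of a Young diagram inside a k × (n-k) box.
--
-- Labels are the natural numbers 1..n (steps of the south-east boundary
-- path).  The shape is determined by the set of row labels (vertical
-- steps): label i is a row label iff  row i ≡ true.  The content of an
-- existing box (i , j) is  plus i j  (true = '+', false = '0').  Values of
-- row / plus outside labels 1..n resp. outside boxes are irrelevant.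

record Filling : Set where
  field
    row  : ℕ → Bool
    plus : ℕ → ℕ → Bool
open Filling public

module _ (n : ℕ) (F : Filling) where

  IsRow : ℕ → Set
  IsRow i = (1 ≤ i) × (i ≤ n) × (row F i ≡ true)

  IsCol : ℕ → Set
  IsCol j = (1 ≤ j) × (j ≤ n) × (row F j ≡ false)

  Box : ℕ → ℕ → Set
  Box i j = IsRow i × IsCol j × (i < j)

  countRows : ℕ → ℕ
  countRows zero    = 0
  countRows (suc m) = (if row F (suc m) then 1 else 0) + countRows m

  -- Le-condition: no box containing 0 has a + above it in its column
  -- (smaller row label) and a + to its left in its row (larger column label).
  IsLe : Set
  IsLe = ∀ i j → Box i j → plus F i j ≡ false →
           ¬ ( (∃ λ i' → Box i' j × i' < i × plus F i' j ≡ true)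
             × (∃ λ j' → Box i j' × j < j' × plus F i j' ≡ true) )

LeDiagram : ℕ → ℕ → Filling → Set
LeDiagram k n F = (countRows n F n ≡ k) × IsLe n F

firstFrom : (ℕ → Bool) → ℕ → ℕ → Maybe ℕ
firstFrom p a zero    = nothing
firstFrom p a (suc m) = if p a then just a else firstFrom p (suc a) m

downFrom : (ℕ → Bool) → ℕ → Maybe ℕ
downFrom p zero    = nothing
downFrom p (suc y) = if p (suc y) then just (suc y) else downFrom p y

-- Decorated permutation (pipe dream: 0 = crossing, + = elbow)

module _ (n : ℕ) (F : Filling) where

  -- pipe moving left in row r, currently right of column position c:
  -- the next elbow is the smallest column label c' > c with + at (r , c')
  nextPlusInRow : ℕ → ℕ → Maybe ℕ
  nextPlusInRow r c = firstFrom (λ c' → not (row F c') ∧ plus F r c') (suc c) (n ∸ c)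

  -- pipe moving up in column c, currently below row position r:
  -- the next elbow is the largest row label r' < r with + at (r' , c)
  nextPlusInCol : ℕ → ℕ → Maybe ℕ
  nextPlusInCol c r = downFrom (λ r' → row F r' ∧ plus F r' c) (r ∸ 1)

  traceL : ℕ → ℕ → ℕ → ℕ
  traceU : ℕ → ℕ → ℕ → ℕ
  traceL zero    r c = 0
  traceL (suc f) r c = maybe (λ c' → traceU f c' r) r (nextPlusInRow r c)
  traceU zero    c r = 0
  traceU (suc f) c r = maybe (λ r' → traceL f r' c) c (nextPlusInCol c r)

  -- enough fuel: each turn strictly increases the column / decreases the row
  fuel : ℕ
  fuel = 2 * n + 2

  -- π̂(i): pipe starting at boundary step i (moving left from a row label,
  -- moving up from a column label) exits at label π̂(i)
  decPerm : ℕ → ℕ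
  decPerm i = if row F i then traceL fuel i i else traceU fuel i i

  CoLoopless : Set
  CoLoopless = ∀ i → IsRow n F i → decPerm i ≢ i

-- The algorithm (specified relationally: D is the output for Dh)

module _ (n : ℕ) (Dh : Filling) where

  aN : ℕ
  aN = decPerm n Dh 1

  rowD : ℕ → Bool
  rowD i = row Dh i ∨ (i ≡ᵇ aN)

  W : ℕ → ℕ
  W r = maybe (λ x → x) (suc n) (firstFrom rowD (suc r) (n ∸ r))

  -- column label of the leftmost + in row r of Dh (∞ = n+1 for row a_n;
  -- default n+1 if there is no +, which cannot happen for co-loopless Dh)
  leftmostPlus : ℕ → ℕ
  leftmostPlus r =
    maybe (λ x → x) (suc n)
      (downFrom (λ c → (r <ᵇ c) ∧ not (row Dh c) ∧ plus Dh r c) n)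

  Lval : ℕ → ℕ
  Lval r = if r ≡ᵇ aN then suc n else leftmostPlus r

  UnrestrictedZero : ℕ → ℕ → Set
  UnrestrictedZero b ℓ =
    (plus Dh b ℓ ≡ false) × (∀ c → IsCol n Dh c → ℓ < c → plus Dh b c ≡ false)

  CondI : ℕ → ℕ → Set
  CondI r ℓ = IsRow n Dh r × (plus Dh r ℓ ≡ true)

  CondII : ℕ → ℕ → Set
  CondII r ℓ = ∃ λ b' → IsRow n Dh b' × r < b' × b' < ℓ × (plus Dh b' ℓ ≡ true)
                 × (∀ b → IsRow n Dh b → r < b → b < b' → UnrestrictedZero b ℓ)

  CondIII : ℕ → ℕ → Set
  CondIII r ℓ = ∀ b → IsRow n Dh b → r < b → b < ℓ → UnrestrictedZero b ℓ

  Cond : ℕ → ℕ → Set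
  Cond r ℓ = CondI r ℓ ⊎ CondII r ℓ ⊎ CondIII r ℓ

  RuleI : ℕ → ℕ → Set
  RuleI r ℓ = (ℓ < W r × ℓ < Lval r) ⊎ (W r < ℓ × ℓ < Lval r × Cond r ℓ)

  TypeII : ℕ → Set
  TypeII r = Box n Dh r aN × (plus Dh r aN ≡ true)

  AlgoPlus : ℕ → ℕ → Set
  AlgoPlus r ℓ =
      (¬ TypeII r × RuleI r ℓ)
    ⊎ (TypeII r × ((ℓ < aN × RuleI r ℓ) ⊎ (aN < ℓ × plus Dh r ℓ ≡ true)))

  IsAlgoOutput : Filling → Set
  IsAlgoOutput D =
      (∀ i → 1 ≤ i → i ≤ n → row D i ≡ rowD i)
    × (∀ r ℓ → Box n D r ℓ → (plus D r ℓ ≡ true) ⇔ AlgoPlus r ℓ)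

{-# OPTIONS --safe #-}
-- The new row a_n = π̂(1) is a column label of D̂: if 1 is a row label, co-looplessness puts a +
-- in row 1 and the pipe from 1 leaves at the leftmost one. So D has exactly one row more than D̂.
-- For the Le-property, let D have a 0 at (i, j) with a + at (i', j) above and a + at (i, j') to
-- its left. Since W(i') ≤ i < j, the + at (i', j) is granted by a + of D̂ in column j above row i,
-- or by (ii) or (iii) at i'; with the Le-property of D̂ this makes every 0 of D̂ in column j from
-- row i downwards unrestricted. If j < L(i), which fails only when row i has type (II) and
-- j > a_n, this yields (i), (ii) or (iii) at (i, j), so D would have a + there. Otherwise D agrees
-- with D̂ at (i, j) and (i, j'), and the 0 at (i, j) would be a restricted 0 of D̂.
module Submission where

open import Defs
open import Data.Nat using (ℕ; zero; suc; _≤_; _<_; _+_; _*_; _∸_; _≡ᵇ_; _<ᵇ_; z≤n; s≤s)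
open import Data.Nat.Properties
  using (≤-refl; ≤-trans; <-trans; <-≤-trans; ≤-<-trans; <-cmp; <-irrefl; <⇒≤; <⇒≢;
         n≤1+n; n<1+n; ≤-pred; m≤n⇒m<n∨m≡n; m<m+n; +-comm; +-suc; m+[n∸m]≡n;
         ≡ᵇ⇒≡; ≡⇒≡ᵇ; <⇒<ᵇ)
open import Data.Bool using (Bool; true; false; not; _∧_; _∨_; if_then_else_)
open import Data.Bool.Properties using (_≟_; T-≡; ¬-not; not-¬; ∨-identityʳ; ∨-zeroʳ)
open import Data.Maybe using (just; nothing; maybe)
open import Data.Product using (∃; _×_; _,_; proj₁; proj₂)
open import Data.Sum using (_⊎_; inj₁; inj₂)
open import Data.Empty using (⊥; ⊥-elim)
open import Function using (id; _∘_)
open import Relation.Nullary using (¬_; yes; no)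
open import Relation.Binary.PropositionalEquality
  using (_≡_; _≢_; refl; sym; trans; cong; cong₂; subst; module ≡-Reasoning)
open import Relation.Binary.Definitions using (tri<; tri≈; tri>)
open import Function.Bundles using (_⇔_; Equivalence)

open Equivalence using (to; from)
open ≡-Reasoning

≡ᵇ-refl : ∀ x → (x ≡ᵇ x) ≡ true
≡ᵇ-refl x = to T-≡ (≡⇒≡ᵇ x x refl)

≡ᵇ-false : ∀ {x y} → x ≢ y → (x ≡ᵇ y) ≡ false
≡ᵇ-false {x} {y} x≢y = ¬-not (x≢y ∘ ≡ᵇ⇒≡ x y ∘ from T-≡)

<ᵇ-true : ∀ {x y} → x < y → (x <ᵇ y) ≡ true
<ᵇ-true x<y = to T-≡ (<⇒<ᵇ x<y)

module _ (p : ℕ → Bool) where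

  firstFrom-sound : ∀ {a m x} → firstFrom p a m ≡ just x → p x ≡ true × a ≤ x × x < a + m
  firstFrom-sound {a} {suc m} {x} found with p a in pa
  firstFrom-sound {a} {suc m} refl | true = pa , ≤-refl , m<m+n a (s≤s z≤n)
  ... | false with firstFrom-sound found
  ... | px , a<x , x<1+a+m = px , <⇒≤ a<x , subst (x <_) (sym (+-suc a m)) x<1+a+m

  firstFrom-minimal : ∀ {a m} d {x} → p x ≡ true → a ≤ x → x < a + m →
                      maybe id d (firstFrom p a m) ≤ x
  firstFrom-minimal {a} {zero} d {x} px a≤x x<a+0 =
    ⊥-elim (<-irrefl refl (≤-<-trans a≤x (subst (x <_) (+-comm a 0) x<a+0)))
  firstFrom-minimal {a} {suc m} d {x} px a≤x x<a+1+m with p a in pa | m≤n⇒m<n∨m≡n a≤x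
  ... | true  | _          = a≤x
  ... | false | inj₁ a<x   = firstFrom-minimal d px a<x (subst (x <_) (+-suc a m) x<a+1+m)
  ... | false | inj₂ refl  = ⊥-elim (not-¬ px pa)

  firstFrom-avoids : ∀ {a m d j} → d ≢ j → p j ≡ false → maybe id d (firstFrom p a m) ≢ j
  firstFrom-avoids {a} {zero}  d≢j pj = d≢j
  firstFrom-avoids {a} {suc m} d≢j pj with p a in pa
  ... | true  = λ a≡j → not-¬ pa (subst (λ z → p z ≡ false) (sym a≡j) pj)
  ... | false = firstFrom-avoids {suc a} {m} d≢j pj

  downFrom-maximal : ∀ {y} d {c} → p c ≡ true → 1 ≤ c → c ≤ y → c ≤ maybe id d (downFrom p y)
  downFrom-maximal {zero}  d pc (s≤s _) ()
  downFrom-maximal {suc y} d {c} pc 1≤c c≤1+y with p (suc y) in py | m≤n⇒m<n∨m≡n c≤1+y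
  ... | true  | _                = c≤1+y
  ... | false | inj₁ (s≤s c≤y)   = downFrom-maximal d pc 1≤c c≤y
  ... | false | inj₂ refl        = ⊥-elim (not-¬ pc py)

-- The pipe leaving the first row turns up at its leftmost +, and nothing lies above row 1.
decPerm-one-row : ∀ n F → row F 1 ≡ true → decPerm n F 1 ≡ maybe id 1 (nextPlusInRow n F 1 1)
decPerm-one-row n F row1 rewrite row1 | +-comm (2 * n) 2 with nextPlusInRow n F 1 1
... | nothing = refl
... | just c  = refl

decPerm-one-col : ∀ n F → row F 1 ≡ false → decPerm n F 1 ≡ 1
decPerm-one-col n F col1 rewrite col1 | +-comm (2 * n) 2 = refl

aN-isCol : ∀ {n F} → 1 ≤ n → CoLoopless n F → IsCol n F (aN n F)
aN-isCol {n} {F} 1≤n coloopless = byFirstRow (row F 1) refl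
  where
  ¬row⇒false : ∀ {c} → not (row F c) ∧ plus F 1 c ≡ true → row F c ≡ false
  ¬row⇒false {c} with row F c
  ... | false = λ _ → refl
  ... | true  = λ ()

  byFirstRow : ∀ b → row F 1 ≡ b → IsCol n F (aN n F)
  byFirstRow false col1 = subst (IsCol n F) (sym (decPerm-one-col n F col1)) (≤-refl , 1≤n , col1)
  byFirstRow true  row1 with nextPlusInRow n F 1 1 in turn | decPerm-one-row n F row1
  ... | nothing | a≡1 = ⊥-elim (coloopless 1 (≤-refl , 1≤n , row1) a≡1)
  ... | just c  | a≡c with firstFrom-sound _ turn
  ...   | plus1c , 2≤c , c<2+[n∸1] =
    subst (IsCol n F) (sym a≡c)
      ( ≤-trans (n≤1+n 1) 2≤c
      , subst (c ≤_) (m+[n∸m]≡n 1≤n) (≤-pred c<2+[n∸1])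
      , ¬row⇒false plus1c )

module _ {n a : ℕ} {F G : Filling} (1≤a : 1 ≤ a) (a∉F : row F a ≡ false)
         (rowG : ∀ i → 1 ≤ i → i ≤ n → row G i ≡ row F i ∨ (i ≡ᵇ a)) where

  private
    indicator : Bool → ℕ
    indicator b = if b then 1 else 0

    indicator-other : ∀ {m} → suc m ≤ n → suc m ≢ a →
                      indicator (row G (suc m)) ≡ indicator (row F (suc m))
    indicator-other {m} 1+m≤n 1+m≢a = cong indicator (begin
      row G (suc m)                       ≡⟨ rowG (suc m) (s≤s z≤n) 1+m≤n ⟩
      row F (suc m) ∨ (suc m ≡ᵇ a)        ≡⟨ cong (row F (suc m) ∨_) (≡ᵇ-false 1+m≢a) ⟩
      row F (suc m) ∨ false               ≡⟨ ∨-identityʳ _ ⟩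
      row F (suc m)                       ∎)

  countRows-before : ∀ m → m ≤ n → m < a → countRows n G m ≡ countRows n F m
  countRows-before zero    _     _     = refl
  countRows-before (suc m) 1+m≤n 1+m<a =
    cong₂ _+_ (indicator-other 1+m≤n (<⇒≢ 1+m<a))
              (countRows-before m (≤-trans (n≤1+n m) 1+m≤n) (<-trans (n<1+n m) 1+m<a))

  countRows-after : ∀ m → m ≤ n → a ≤ m → countRows n G m ≡ suc (countRows n F m)
  countRows-after zero    _     a≤0 with ≤-trans 1≤a a≤0
  ... | ()
  countRows-after (suc m) 1+m≤n a≤1+m with m≤n⇒m<n∨m≡n a≤1+m
  ... | inj₂ refl rewrite rowG a 1≤a 1+m≤n | a∉F | ≡ᵇ-refl a =
    cong suc (countRows-before m (≤-trans (n≤1+n m) 1+m≤n) (n<1+n m))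
  ... | inj₁ a<1+m =
    trans (cong₂ _+_ (indicator-other 1+m≤n (λ e → <⇒≢ a<1+m (sym e)))
                     (countRows-after m (≤-trans (n≤1+n m) 1+m≤n) (≤-pred a<1+m)))
          (+-suc _ _)

module _ {n : ℕ} {Dh : Filling} where

  ¬CondII⇒CondIII : ∀ {r ℓ} → ¬ CondII n Dh r ℓ →
    (∀ b → IsRow n Dh b → r < b → b < ℓ → plus Dh b ℓ ≡ false → UnrestrictedZero n Dh b ℓ) →
    CondIII n Dh r ℓ
  ¬CondII⇒CondIII {r} {ℓ} ¬II zero⇒unrestricted b rb r<b b<ℓ = below (suc b) (n<1+n b) rb r<b b<ℓ
    where
    below : ∀ m {b} → b < m → IsRow n Dh b → r < b → b < ℓ → UnrestrictedZero n Dh b ℓ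
    below (suc m) {b} b<1+m rb r<b b<ℓ with plus Dh b ℓ ≟ true
    ... | no ¬pbℓ = zero⇒unrestricted b rb r<b b<ℓ (¬-not ¬pbℓ)
    ... | yes pbℓ = ⊥-elim (¬II (b , rb , r<b , b<ℓ , pbℓ , λ b' rb' r<b' b'<b →
                      below m (<-≤-trans b'<b (≤-pred b<1+m)) rb' r<b' (<-trans b'<b b<ℓ)))

  PlusAbove : ℕ → ℕ → ℕ → Set
  PlusAbove i' i j =
    (∃ λ p → IsRow n Dh p × p < i × plus Dh p j ≡ true) ⊎ CondII n Dh i' j ⊎ CondIII n Dh i' j

  PlusAbove-mono : ∀ {i' i b j} → i < b → PlusAbove i' i j → PlusAbove i' b j
  PlusAbove-mono i<b (inj₁ (p , rp , p<i , ppj)) = inj₁ (p , rp , <-trans p<i i<b , ppj)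
  PlusAbove-mono i<b (inj₂ cond)                 = inj₂ cond

  module _ (leDh : IsLe n Dh) where

    zero-below-plus-unrestricted : ∀ {p b j} → IsRow n Dh p → IsRow n Dh b → IsCol n Dh j →
      p < b → b < j → plus Dh p j ≡ true → plus Dh b j ≡ false → UnrestrictedZero n Dh b j
    zero-below-plus-unrestricted {p} {b} {j} rp rb cj p<b b<j ppj pbj = pbj , no-plus-left
      where
      no-plus-left : ∀ c → IsCol n Dh c → j < c → plus Dh b c ≡ false
      no-plus-left c cc j<c = ¬-not λ pbc →
        leDh b j (rb , cj , b<j) pbj ( (p , (rp , cj , <-trans p<b b<j) , p<b , ppj)
                                     , (c , (rb , cc , <-trans b<j j<c) , j<c , pbc) )

    PlusAbove⇒unrestricted : ∀ {i' i j} → IsRow n Dh i → IsCol n Dh j → i' < i → i < j →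
      plus Dh i j ≡ false → PlusAbove i' i j → UnrestrictedZero n Dh i j
    PlusAbove⇒unrestricted ri cj i'<i i<j pij (inj₁ (p , rp , p<i , ppj)) =
      zero-below-plus-unrestricted rp ri cj p<i i<j ppj pij
    PlusAbove⇒unrestricted ri cj i'<i i<j pij (inj₂ (inj₂ III)) = III _ ri i'<i i<j
    PlusAbove⇒unrestricted {i = i} ri cj i'<i i<j pij (inj₂ (inj₁ (b' , rb' , _ , _ , pb'j , between)))
      with <-cmp b' i
    ... | tri< b'<i _ _ = zero-below-plus-unrestricted rb' ri cj b'<i i<j pb'j pij
    ... | tri≈ _ refl _ = ⊥-elim (not-¬ pb'j pij)
    ... | tri> _ _ i<b' = between i ri i'<i i<b'

    PlusAbove⇒¬¬Cond : ∀ {i' i j} → IsCol n Dh j → i' < i → PlusAbove i' i j → ¬ ¬ Cond n Dh i j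
    PlusAbove⇒¬¬Cond cj i'<i above ¬cond =
      ¬cond (inj₂ (inj₂ (¬CondII⇒CondIII (¬cond ∘ inj₂ ∘ inj₁) λ b rb i<b b<j pbj →
        PlusAbove⇒unrestricted rb cj (<-trans i'<i i<b) b<j pbj (PlusAbove-mono i<b above))))

module AlgorithmOutput {n : ℕ} {Dh D : Filling} (leDh : IsLe n Dh)
    (rowEq : ∀ i → 1 ≤ i → i ≤ n → row D i ≡ rowD n Dh i)
    (plusIff : ∀ r ℓ → Box n D r ℓ → (plus D r ℓ ≡ true) ⇔ AlgoPlus n Dh r ℓ) where

  private
    a : ℕ
    a = aN n Dh

    ∨-falseˡ : ∀ x {y} → x ∨ y ≡ false → x ≡ false
    ∨-falseˡ false _ = refl

  rowD-aN : rowD n Dh a ≡ true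
  rowD-aN = trans (cong (row Dh a ∨_) (≡ᵇ-refl a)) (∨-zeroʳ _)

  IsCol-D⇒rowD-false : ∀ {j} → IsCol n D j → rowD n Dh j ≡ false
  IsCol-D⇒rowD-false {j} (1≤j , j≤n , colj) = trans (sym (rowEq j 1≤j j≤n)) colj

  IsCol-D⇒IsCol-Dh : ∀ {j} → IsCol n D j → IsCol n Dh j
  IsCol-D⇒IsCol-Dh {j} cj@(1≤j , j≤n , _) = 1≤j , j≤n , ∨-falseˡ (row Dh j) (IsCol-D⇒rowD-false cj)

  W≤nextRow : ∀ {r x} → IsRow n D x → r < x → W n Dh r ≤ x
  W≤nextRow {r} {x} (1≤x , x≤n , rowx) r<x =
    firstFrom-minimal (rowD n Dh) (suc n) (trans (sym (rowEq x 1≤x x≤n)) rowx) r<x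
      (subst (λ m → x < suc m) (sym (m+[n∸m]≡n (≤-trans (<⇒≤ r<x) x≤n))) (s≤s x≤n))

  W≢col : ∀ {r j} → IsCol n D j → W n Dh r ≢ j
  W≢col {r} {j} cj@(_ , j≤n , _) =
    firstFrom-avoids (rowD n Dh) {suc r} {n ∸ r} (λ 1+n≡j → <⇒≢ (s≤s j≤n) (sym 1+n≡j))
      (IsCol-D⇒rowD-false cj)

  aN≤Lval : ∀ {i} → TypeII n Dh i → a ≤ Lval n Dh i
  aN≤Lval {i} ((_ , (1≤a , a≤n , cola) , i<a) , pia) rewrite ≡ᵇ-false (<⇒≢ i<a) =
    downFrom-maximal (λ c → (i <ᵇ c) ∧ not (row Dh c) ∧ plus Dh i c) (suc n) plusAt-a 1≤a a≤n
    where
    plusAt-a : (i <ᵇ a) ∧ not (row Dh a) ∧ plus Dh i a ≡ true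
    plusAt-a rewrite <ᵇ-true i<a | cola | pia = refl

  -- As W(i') ≤ i < j, only (i), (ii), (iii) or a + of D̂ in a type (II) row can put the + at (i', j).
  plusD⇒PlusAbove : ∀ {i' i j} → Box n D i' j → i' < i → IsRow n D i → i < j →
    plus D i' j ≡ true → PlusAbove i' i j
  plusD⇒PlusAbove {i'} {i} {j} box i'<i ri i<j pi'j = fromAlgo (to (plusIff i' j box) pi'j)
    where
    fromRule : RuleI n Dh i' j → PlusAbove i' i j
    fromRule (inj₁ (j<W , _)) = ⊥-elim (<-irrefl refl (<-trans j<W (≤-<-trans (W≤nextRow ri i'<i) i<j)))
    fromRule (inj₂ (_ , _ , inj₁ (ri' , pi'j))) = inj₁ (i' , ri' , i'<i , pi'j)
    fromRule (inj₂ (_ , _ , inj₂ cond))        = inj₂ cond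

    fromAlgo : AlgoPlus n Dh i' j → PlusAbove i' i j
    fromAlgo (inj₁ (_ , rule))                     = fromRule rule
    fromAlgo (inj₂ (_ , inj₁ (_ , rule)))          = fromRule rule
    fromAlgo (inj₂ ((box' , _) , inj₂ (_ , pi'j))) = inj₁ (i' , proj₁ box' , i'<i , pi'j)

  Cond⇒RuleI : ∀ {i j} → IsCol n D j → j < Lval n Dh i → Cond n Dh i j → RuleI n Dh i j
  Cond⇒RuleI {i} {j} cj j<L cond with <-cmp j (W n Dh i)
  ... | tri< j<W _   _   = inj₁ (j<W , j<L)
  ... | tri≈ _   j≡W _   = ⊥-elim (W≢col {i} cj (sym j≡W))
  ... | tri> _   _   W<j = inj₂ (W<j , j<L , cond)

  RuleI⇒<Lval : ∀ {i j} → RuleI n Dh i j → j < Lval n Dh i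
  RuleI⇒<Lval (inj₁ (_ , j<L))     = j<L
  RuleI⇒<Lval (inj₂ (_ , j<L , _)) = j<L

  isLe : IsLe n D
  isLe i j box@(ri , cj , i<j) pij ((i' , box' , i'<i , pi'j) , (j' , boxj'@(_ , cj' , _) , j<j' , pij')) =
    bySource (to (plusIff i j' boxj') pij')
    where
    above : PlusAbove i' i j
    above = plusD⇒PlusAbove box' i'<i ri i<j pi'j

    ¬algo : ¬ AlgoPlus n Dh i j
    ¬algo algo = not-¬ (from (plusIff i j box) algo) pij

    ¬¬rule : j < Lval n Dh i → ¬ ¬ RuleI n Dh i j
    ¬¬rule j<L ¬rule =
      PlusAbove⇒¬¬Cond leDh (IsCol-D⇒IsCol-Dh cj) i'<i above (¬rule ∘ Cond⇒RuleI cj j<L)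

    bySource : AlgoPlus n Dh i j' → ⊥
    bySource (inj₁ (¬II , rule')) =
      ¬¬rule (<-trans j<j' (RuleI⇒<Lval rule')) (¬algo ∘ inj₁ ∘ (¬II ,_))
    bySource (inj₂ (II , source)) with <-cmp j a
    ... | tri< j<a _ _ =
      ¬¬rule (<-≤-trans j<a (aN≤Lval II)) (λ rule → ¬algo (inj₂ (II , inj₁ (j<a , rule))))
    ... | tri≈ _ refl _ = not-¬ rowD-aN (IsCol-D⇒rowD-false cj)
    ... | tri> _ _ a<j with source
    ...   | inj₁ (j'<a , _) = ⊥-elim (<-irrefl refl (<-trans a<j (<-trans j<j' j'<a)))
    ...   | inj₂ (_ , pDh-ij') =
      not-¬ pDh-ij' (proj₂ unrestricted j' (IsCol-D⇒IsCol-Dh cj') j<j')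
      where
      pDh-ij : plus Dh i j ≡ false
      pDh-ij = ¬-not (λ p → ¬algo (inj₂ (II , inj₂ (a<j , p))))

      unrestricted : UnrestrictedZero n Dh i j
      unrestricted =
        PlusAbove⇒unrestricted leDh (proj₁ (proj₁ II)) (IsCol-D⇒IsCol-Dh cj) i'<i i<j pDh-ij above

mainTheorem9 : ∀ {k n : ℕ} (Dh D : Filling) → 1 ≤ n →
                   LeDiagram k n Dh → CoLoopless n Dh →
                   IsAlgoOutput n Dh D → LeDiagram (suc k) n D
mainTheorem9 {k} {n} Dh D 1≤n (rows≡k , leDh) coloopless (rowEq , plusIff)
  with aN-isCol 1≤n coloopless
... | 1≤a , a≤n , cola =
  trans (countRows-after 1≤a cola rowEq n ≤-refl a≤n) (cong suc rows≡k) ,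
  AlgorithmOutput.isLe leDh rowEq plusIff
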